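{- Let $G$ be a finite simple graph and let $v$ be a simplicial vertex of $G$. If $S$ is a strong stable set of $G\setminus\{v\}$, then either $S$ or $S\cup\{v\}$ is a strong stable set of $G$.
   Context: A vertex $v$ is simplicial if its neighbourhood $N(v)$ is a clique. A maximal clique is a clique not contained in a larger clique. A strong stable set of a graph is a stable set meeting every nonempty maximal clique of the graph. -}

module Defs where

open import Data.Nat using (ℕ)
open import Data.Fin using (Fin)
open import Data.Fin.Subset using (Subset; _∈_; _⊆_; _∩_; Nonempty)
open import Data.Product using (_×_)
open import Relation.Binary.PropositionalEquality using (_≢_)
open import Relation.Nullary using (¬_; Dec)

record Graph (n : ℕ) : Set₁ where
  field
    Adj     : Fin n → Fin n → Set
    sym     : ∀ {x y} → Adj x y → Adj y x
    irrefl  : ∀ {x} → ¬ Adj x x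
    adj?    : ∀ x y → Dec (Adj x y)

open Graph public

-- All notions below are relative to the induced subgraph G[U] on the
-- vertex set U ⊆ Fin n.  G itself is G[⊤], and G ∖ {v} is G[∁ ⁅ v ⁆].

IsClique : ∀ {n} → Graph n → Subset n → Subset n → Set
IsClique G U K = K ⊆ U × (∀ x y → x ∈ K → y ∈ K → x ≢ y → Adj G x y)

IsMaximalClique : ∀ {n} → Graph n → Subset n → Subset n → Set
IsMaximalClique G U K =
  IsClique G U K × (∀ K′ → IsClique G U K′ → K ⊆ K′ → K′ ⊆ K)

IsStable : ∀ {n} → Graph n → Subset n → Subset n → Set
IsStable G U S = S ⊆ U × (∀ x y → x ∈ S → y ∈ S → ¬ Adj G x y)

IsStrongStable : ∀ {n} → Graph n → Subset n → Subset n → Set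
IsStrongStable G U S =
  IsStable G U S × (∀ K → IsMaximalClique G U K → Nonempty K → Nonempty (S ∩ K))

IsSimplicial : ∀ {n} → Graph n → Fin n → Set
IsSimplicial G v = ∀ x y → Adj G v x → Adj G v y → x ≢ y → Adj G x y

-- If S contains a neighbour u of v, then S already works: a maximal clique avoiding v is a
-- maximal clique of G ∖ {v}, and one containing v lies in the clique N[v], so maximality forces
-- it to contain u.  Otherwise v has no neighbour in S, so S ∪ {v} is stable, and v itself meets
-- every maximal clique through v.
module Submission where

open import Defs
open import Data.Fin using (Fin; _≟_)
open import Data.Fin.Subset using (Subset; ⊤; ∁; ⁅_⁆; _∪_; _∩_; _∈_; _∉_; _⊆_; Nonempty)
open import Data.Fin.Subset.Properties
  using (⊆⊤; _∈?_; x∈⁅x⁆; x∈⁅y⁆⇒x≡y; x∉p⇒x∈∁p;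
         p⊆p∪q; q⊆p∪q; x∈p∪q⁻; x∈p∩q⁺; x∈p∩q⁻)
open import Data.Fin.Properties using (any?)
open import Data.Sum using (_⊎_; inj₁; inj₂)
open import Data.Product using (_,_; proj₁; proj₂)
open import Relation.Nullary using (¬_; yes; no)
open import Relation.Nullary.Decidable using (_×-dec_)
open import Relation.Binary.PropositionalEquality using (_≡_; refl; subst; _≢_)
  renaming (sym to ≡-sym)
open import Data.Empty using (⊥-elim)

module _ {n} (G : Graph n) where

  maximalClique-restrict : ∀ {U W K} → K ⊆ W → W ⊆ U →
    IsMaximalClique G U K → IsMaximalClique G W K
  maximalClique-restrict K⊆W W⊆U ((_ , adj) , maximal) =
    (K⊆W , adj) , λ K′ (K′⊆W , adj′) → maximal K′ ((λ x∈K′ → W⊆U (K′⊆W x∈K′)) , adj′)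

  ClosedNeighbour : Fin n → Fin n → Set
  ClosedNeighbour v x = x ≡ v ⊎ Adj G v x

  clique∋v⇒closedNeighbours : ∀ {U K v} → IsClique G U K → v ∈ K →
    ∀ {x} → x ∈ K → ClosedNeighbour v x
  clique∋v⇒closedNeighbours {v = v} (_ , adj) v∈K {x} x∈K with x ≟ v
  ... | yes x≡v = inj₁ x≡v
  ... | no  x≢v = inj₂ (adj v x v∈K x∈K (λ v≡x → x≢v (≡-sym v≡x)))

  simplicial⇒closedNeighbours-clique : ∀ {v} → IsSimplicial G v → ∀ K →
    (∀ {x} → x ∈ K → ClosedNeighbour v x) → IsClique G ⊤ K
  simplicial⇒closedNeighbours-clique {v} simplicial K closed =
    ⊆⊤ , λ x y x∈K y∈K x≢y → adjacent (closed x∈K) (closed y∈K) x≢y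
    where
    adjacent : ∀ {x y} → ClosedNeighbour v x → ClosedNeighbour v y → x ≢ y → Adj G x y
    adjacent (inj₁ refl) (inj₁ refl) x≢y = ⊥-elim (x≢y refl)
    adjacent (inj₁ refl) (inj₂ vy)   _   = vy
    adjacent (inj₂ vx)   (inj₁ refl) _   = sym G vx
    adjacent (inj₂ vx)   (inj₂ vy)   x≢y = simplicial _ _ vx vy x≢y

  simplicial-maximalClique∋v-∋neighbour : ∀ {v u K} → IsSimplicial G v →
    IsMaximalClique G ⊤ K → v ∈ K → Adj G v u → u ∈ K
  simplicial-maximalClique∋v-∋neighbour {v} {u} {K} simplicial (clique , maximal) v∈K vu =
    maximal (K ∪ ⁅ u ⁆) extended (p⊆p∪q ⁅ u ⁆) (q⊆p∪q K ⁅ u ⁆ (x∈⁅x⁆ u))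
    where
    closed : ∀ {x} → x ∈ K ∪ ⁅ u ⁆ → ClosedNeighbour v x
    closed x∈K∪u with x∈p∪q⁻ K ⁅ u ⁆ x∈K∪u
    ... | inj₁ x∈K = clique∋v⇒closedNeighbours clique v∈K x∈K
    ... | inj₂ x∈u with x∈⁅y⁆⇒x≡y u x∈u
    ...   | refl = inj₂ vu

    extended : IsClique G ⊤ (K ∪ ⁅ u ⁆)
    extended = simplicial⇒closedNeighbours-clique simplicial (K ∪ ⁅ u ⁆) closed

  module _ {v : Fin n} {S : Subset n} (strong : IsStrongStable G (∁ ⁅ v ⁆) S) where

    strongStable-meets-maximalClique∌v : ∀ {K} → IsMaximalClique G ⊤ K → v ∉ K →
      Nonempty K → Nonempty (S ∩ K)
    strongStable-meets-maximalClique∌v {K} maximalK v∉K =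
      proj₂ strong K (maximalClique-restrict K⊆G∖v ⊆⊤ maximalK)
      where
      K⊆G∖v : K ⊆ ∁ ⁅ v ⁆
      K⊆G∖v x∈K = x∉p⇒x∈∁p (λ x∈v → v∉K (subst (_∈ K) (x∈⁅y⁆⇒x≡y v x∈v) x∈K))

    strongStable-∋neighbour : ∀ {u} → IsSimplicial G v → u ∈ S → Adj G v u →
      IsStrongStable G ⊤ S
    strongStable-∋neighbour simplicial u∈S vu = (⊆⊤ , proj₂ (proj₁ strong)) , meets
      where
      meets : ∀ K → IsMaximalClique G ⊤ K → Nonempty K → Nonempty (S ∩ K)
      meets K maximalK with v ∈? K
      ... | no  v∉K = strongStable-meets-maximalClique∌v maximalK v∉K
      ... | yes v∈K = λ _ →
        _ , x∈p∩q⁺ (u∈S , simplicial-maximalClique∋v-∋neighbour simplicial maximalK v∈K vu)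

    strongStable-∪-nonNeighbour : (∀ {x} → x ∈ S → ¬ Adj G v x) →
      IsStrongStable G ⊤ (S ∪ ⁅ v ⁆)
    strongStable-∪-nonNeighbour isolated = (⊆⊤ , stable) , meets
      where
      independent : ∀ x y → x ∈ S → y ∈ S → ¬ Adj G x y
      independent = proj₂ (proj₁ strong)

      S∪v⁻ : ∀ {x} → x ∈ S ∪ ⁅ v ⁆ → x ∈ S ⊎ x ≡ v
      S∪v⁻ x∈S∪v with x∈p∪q⁻ S ⁅ v ⁆ x∈S∪v
      ... | inj₁ x∈S = inj₁ x∈S
      ... | inj₂ x∈v = inj₂ (x∈⁅y⁆⇒x≡y v x∈v)

      stable : ∀ x y → x ∈ S ∪ ⁅ v ⁆ → y ∈ S ∪ ⁅ v ⁆ → ¬ Adj G x y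
      stable x y x∈S∪v y∈S∪v with S∪v⁻ x∈S∪v | S∪v⁻ y∈S∪v
      ... | inj₁ x∈S | inj₁ y∈S = independent x y x∈S y∈S
      ... | inj₁ x∈S | inj₂ refl = λ xv → isolated x∈S (sym G xv)
      ... | inj₂ refl | inj₁ y∈S = isolated y∈S
      ... | inj₂ refl | inj₂ refl = irrefl G

      meets : ∀ K → IsMaximalClique G ⊤ K → Nonempty K → Nonempty ((S ∪ ⁅ v ⁆) ∩ K)
      meets K maximalK with v ∈? K
      ... | yes v∈K = λ _ → v , x∈p∩q⁺ (q⊆p∪q S ⁅ v ⁆ (x∈⁅x⁆ v) , v∈K)
      ... | no  v∉K = λ nonempty →
        let x , x∈S∩K = strongStable-meets-maximalClique∌v maximalK v∉K nonempty
            x∈S , x∈K = x∈p∩q⁻ S K x∈S∩K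
        in x , x∈p∩q⁺ (p⊆p∪q ⁅ v ⁆ x∈S , x∈K)

mainTheorem2 : ∀ {n} (G : Graph n) (v : Fin n) → IsSimplicial G v →
    (S : Subset n) → IsStrongStable G (∁ ⁅ v ⁆) S →
    IsStrongStable G ⊤ S ⊎ IsStrongStable G ⊤ (S ∪ ⁅ v ⁆)
mainTheorem2 G v simplicial S strong
  with any? (λ x → (x ∈? S) ×-dec adj? G v x)
... | yes (u , u∈S , vu) = inj₁ (strongStable-∋neighbour G strong simplicial u∈S vu)
... | no  noNeighbour    =
  inj₂ (strongStable-∪-nonNeighbour G strong (λ {x} x∈S vx → noNeighbour (x , x∈S , vx)))
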